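{- Let $G$ be a finite group of order $n$ with Cayley table $L$, and suppose $L$ contains a maximal partial transversal of length $\ell<\frac35 n$. Then $n$ is even, $G$ contains a subgroup of index $2$, and $\ell-\frac n2$ is even.
   Context: The Cayley table of $G$ is the Latin square with rows and columns indexed by $G$ whose cell $(g,h)$ contains $gh$, viewed as the set of triples $(g,h,gh)$. A partial transversal is a set of triples containing at most one triple in each row, at most one in each column, and at most one with each symbol; its length is its number of triples. It is maximal if not contained in a longer partial transversal. -}

module Defs where

open import Data.Nat using (ℕ; _<_; _*_)
open import Data.Fin using (Fin)
open import Data.Fin.Subset using (Subset; _∈_; ∣_∣)
open import Data.Product using (_×_; _,_; Σ; ∃)
open import Function.Definitions using (Injective)
open import Relation.Binary.PropositionalEquality using (_≡_)
open import Relation.Nullary using (¬_)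
open import Algebra.Structures using (IsGroup)

-- A finite group of order n, realised on the carrier Fin n with
-- propositional equality (every finite group of order n is isomorphic
-- to such a group).
record FinGroup (n : ℕ) : Set where
  field
    _∙_     : Fin n → Fin n → Fin n
    ε       : Fin n
    _⁻¹     : Fin n → Fin n
    isGroup : IsGroup _≡_ _∙_ ε _⁻¹
  infixl 7 _∙_

module _ {n : ℕ} (G : FinGroup n) where
  open FinGroup G

  -- The Cayley table consists of the triples (g , h , g ∙ h).
  record PartialTransversal (ℓ : ℕ) : Set where
    field
      row    : Fin ℓ → Fin n
      col    : Fin ℓ → Fin n
      rowInj : Injective _≡_ _≡_ row
      colInj : Injective _≡_ _≡_ col
      symInj : Injective _≡_ _≡_ (λ i → row i ∙ col i)

  open PartialTransversal

  _⊆T_ : {ℓ ℓ' : ℕ} → PartialTransversal ℓ → PartialTransversal ℓ' → Set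
  T ⊆T T' = ∀ i → ∃ λ j → (row T' j ≡ row T i) × (col T' j ≡ col T i)

  Maximal : {ℓ : ℕ} → PartialTransversal ℓ → Set
  Maximal {ℓ} T = ∀ ℓ' (T' : PartialTransversal ℓ') → ℓ < ℓ' → ¬ (T ⊆T T')

  record IsSubgroup (H : Subset n) : Set where
    field
      ε∈  : ε ∈ H
      ∙∈  : ∀ {x y} → x ∈ H → y ∈ H → (x ∙ y) ∈ H
      ⁻¹∈ : ∀ {x} → x ∈ H → (x ⁻¹) ∈ H

  -- H has index 2 in G, i.e. |G| = 2 |H| (Lagrange: |G : H| = |G| / |H|).
  HasSubgroupOfIndex2 : Set
  HasSubgroupOfIndex2 = Σ (Subset n) λ H → IsSubgroup H × (n ≡ 2 * ∣ H ∣)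

module Submission where

-- Let A, B, C be the rows, columns and symbols missed by T; each has k = n - ℓ elements,
-- maximality says ab ∉ C for a ∈ A, b ∈ B, and 5ℓ < 3n says 2ℓ < 3k.  If g = a'a⁻¹ with
-- a, a' ∈ A, the k-sets a⁻¹C and a'⁻¹C lie among the ℓ used columns, so |C ∩ g⁻¹C| ≥ 2k - ℓ;
-- symmetrically with A and C exchanged.  With |P ∩ g⁻¹P| + |P ∩ h⁻¹P| ≤ |P ∩ (gh)⁻¹P| + |P|
-- and 2ℓ < 3k this makes H = AA⁻¹ = CC⁻¹ closed under products.  As |H| ≥ k > n/3 and H is
-- proper (Σ_g |A ∩ g⁻¹A| = k² < n(2k - ℓ)), H has index 2.  A and C lie in single cosets,
-- and so does B: if a₀b (a₀ ∈ A, b ∈ B) and c₀ ∈ C were in one coset, so would be the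
-- disjoint k-sets Ab and C, forcing 4k ≤ n.  Let p : G → ℤ/2 be the homomorphism with kernel H.  The rows,
-- columns and symbols of T contain m - k·p(A), m - k·p(B), m - k·p(C) elements outside H,
-- where m = n/2 and p(A) + p(B) + p(C) is odd; since p(rc) = p(r) + p(c) these numbers sum
-- to an even number, hence k ≡ m and ℓ - m = m - k is even.

open import Defs
open import Algebra.Bundles using (Group)
import Algebra.Properties.Group as GroupProperties
open import Algebra.Structures using (IsGroup)
open import Data.Bool using (Bool; true; false; not; _∧_; _∨_; _xor_; T)
open import Data.Bool.Properties
  using (T?; T-∧; T-∨; T-≡; T-not-≡; ∧-zeroʳ; ∧-identityʳ; ∧-comm; ∧-distribˡ-∨;
         xor-same; not-injective; not-involutive; ¬-not)
open import Data.Empty using (⊥; ⊥-elim)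
open import Data.Fin using (Fin; zero; suc)
open import Data.Fin.Permutation using (permutation)
open import Data.Fin.Properties using (_≟_; any?; suc-injective; 0≢1+n; ¬∀⟶∃¬)
open import Data.Fin.Subset using (_∈_; ∣_∣)
open import Data.Integer using (ℤ; +_; _-_)
import Data.Integer as ℤ using (_+_; _*_)
import Data.Integer.Properties as ℤ using (pos-*)
open import Data.Integer.Tactic.RingSolver using () renaming (solve-∀ to ℤ-solve-∀)
open import Data.List using ([]; _∷_)
open import Data.Nat using (ℕ; zero; suc; _+_; _*_; _<_; _≤_; _<ᵇ_; z≤n; z<s; >-nonZero)
open import Data.Nat.Properties hiding (_≟_; suc-injective; 0≢1+n)
open import Data.Nat.Tactic.RingSolver using (solve)
open import Data.Product using (Σ; ∃; _×_; _,_; proj₁; proj₂)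
open import Data.Sum using (inj₁; inj₂; [_,_]′)
open import Data.Vec using (tabulate)
import Data.Vec.Functional as Vector
open import Data.Vec.Properties using (lookup∘tabulate; []=⇒lookup; lookup⇒[]=)
open import Function using (_∘_; flip; Equivalence)
open import Function.Definitions using (Injective)
open import Level using (0ℓ)
open import Relation.Binary.PropositionalEquality
  using (_≡_; _≢_; refl; sym; trans; cong; cong₂; subst; module ≡-Reasoning)
open import Relation.Nullary using (¬_; does; yes; no)
open import Relation.Nullary.Decidable using (dec-false; decidable-stable)

open import Algebra.Properties.CommutativeMonoid.Sum +-0-commutativeMonoid
  using (sum-syntax; ∑-distrib-+; ∑-comm; sum-permute; sum-cong-≗; sum-replicate-zero)
open import Algebra.Properties.Semiring.Sum +-*-semiring using (*-distribʳ-sum)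

private
  variable
    a b : Bool

T⇒≡true : T a → a ≡ true
T⇒≡true = Equivalence.to T-≡

¬T⇒≡false : ¬ T a → a ≡ false
¬T⇒≡false = dec-false (T? _)

T-∧⁻ : T (a ∧ b) → T a × T b
T-∧⁻ = Equivalence.to T-∧

T-∧⁺ : T a → T b → T (a ∧ b)
T-∧⁺ Ta Tb = Equivalence.from T-∧ (Ta , Tb)

-- Counting boolean predicates on Fin n

[_] : Bool → ℕ
[ true ]  = 1
[ false ] = 0

count : ∀ {n} → (Fin n → Bool) → ℕ
count {n} P = ∑[ x < n ] [ P x ]

[]-mono-≤ : (T a → T b) → [ a ] ≤ [ b ]
[]-mono-≤ {false}         _   = z≤n
[]-mono-≤ {true}  {true}  _   = ≤-refl
[]-mono-≤ {true}  {false} a⇒b = ⊥-elim (a⇒b _)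

count-cong : ∀ {n} {P Q : Fin n → Bool} → (∀ x → P x ≡ Q x) → count P ≡ count Q
count-cong P≗Q = sum-cong-≗ (cong [_] ∘ P≗Q)

count-mono-≤ : ∀ {n} {P Q : Fin n → Bool} → (∀ x → T (P x) → T (Q x)) → count P ≤ count Q
count-mono-≤ {n = zero}  _   = z≤n
count-mono-≤ {n = suc n} P⊆Q = +-mono-≤ ([]-mono-≤ (P⊆Q zero)) (count-mono-≤ (P⊆Q ∘ suc))

count-false : ∀ {n} → count {n} (λ _ → false) ≡ 0
count-false {n} = sum-replicate-zero n

count-true : ∀ {n} → count {n} (λ _ → true) ≡ n
count-true {zero}  = refl
count-true {suc n} = cong suc (count-true {n})

count≤n : ∀ {n} {P : Fin n → Bool} → count P ≤ n
count≤n {n} {P} = subst (count P ≤_) (count-true {n}) (count-mono-≤ {P = P} (λ _ _ → _))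

count-all : ∀ {n} {P : Fin n → Bool} → (∀ x → T (P x)) → count P ≡ n
count-all {n} {P} all =
  ≤-antisym count≤n (subst (_≤ count P) (count-true {n}) (count-mono-≤ (λ x _ → all x)))

0<count⇒∃ : ∀ {n} {P : Fin n → Bool} → 0 < count P → ∃ λ x → T (P x)
0<count⇒∃ {n = suc n} {P} 0<c with T? (P zero)
... | yes P0 = zero , P0
... | no ¬P0 rewrite ¬T⇒≡false ¬P0 =
  let x , Px = 0<count⇒∃ 0<c in suc x , Px

∃⇒0<count : ∀ {n} {P : Fin n → Bool} x → T (P x) → 0 < count P
∃⇒0<count {P = P} zero    Px rewrite T⇒≡true Px = z<s
∃⇒0<count {P = P} (suc x) Px = <-≤-trans (∃⇒0<count {P = P ∘ suc} x Px) (m≤n+m _ [ P zero ])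

count-+-cong : ∀ {n} {P Q R S : Fin n → Bool} →
  (∀ x → [ P x ] + [ Q x ] ≡ [ R x ] + [ S x ]) → count P + count Q ≡ count R + count S
count-+-cong {P = P} {Q} {R} {S} eq = begin
  count P + count Q                 ≡⟨ ∑-distrib-+ (λ x → [ P x ]) (λ x → [ Q x ]) ⟨
  ∑[ x < _ ] ([ P x ] + [ Q x ])    ≡⟨ sum-cong-≗ eq ⟩
  ∑[ x < _ ] ([ R x ] + [ S x ])    ≡⟨ ∑-distrib-+ (λ x → [ R x ]) (λ x → [ S x ]) ⟩
  count R + count S                 ∎
  where open ≡-Reasoning

count-+ : ∀ {n} {P Q R : Fin n → Bool} →
  (∀ x → [ P x ] + [ Q x ] ≡ [ R x ]) → count P + count Q ≡ count R
count-+ {P = P} {Q} eq = trans (sym (∑-distrib-+ (λ x → [ P x ]) (λ x → [ Q x ]))) (sum-cong-≗ eq)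

count-∧-∨ : ∀ {n} (P Q : Fin n → Bool) →
  count (λ x → P x ∧ Q x) + count (λ x → P x ∨ Q x) ≡ count P + count Q
count-∧-∨ P Q = count-+-cong λ x → pointwise (P x) (Q x)
  where
  pointwise : ∀ a b → [ a ∧ b ] + [ a ∨ b ] ≡ [ a ] + [ b ]
  pointwise true  true  = refl
  pointwise true  false = refl
  pointwise false true  = refl
  pointwise false false = refl

count-split : ∀ {n} (P Q : Fin n → Bool) →
  count (λ x → P x ∧ Q x) + count (λ x → P x ∧ not (Q x)) ≡ count P
count-split P Q = count-+ λ x → pointwise (P x) (Q x)
  where
  pointwise : ∀ a b → [ a ∧ b ] + [ a ∧ not b ] ≡ [ a ]
  pointwise true  true  = refl
  pointwise true  false = refl
  pointwise false _     = refl

count-not : ∀ {n} (P : Fin n → Bool) → count P + count (not ∘ P) ≡ n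
count-not P = trans (count-split (λ _ → true) P) count-true

count-∨-disjoint : ∀ {n} (P Q : Fin n → Bool) → (∀ x → T (P x) → T (Q x) → ⊥) →
  count (λ x → P x ∨ Q x) ≡ count P + count Q
count-∨-disjoint P Q disjoint = sym (count-+ λ x → pointwise (disjoint x))
  where
  pointwise : (T a → T b → ⊥) → [ a ] + [ b ] ≡ [ a ∨ b ]
  pointwise {false}         _ = refl
  pointwise {true}  {false} _ = refl
  pointwise {true}  {true}  h = ⊥-elim (h _ _)

count-overlap : ∀ {n} (P Q R : Fin n → Bool) →
  (∀ x → T (P x) → T (R x)) → (∀ x → T (Q x) → T (R x)) →
  count P + count Q ≤ count (λ x → P x ∧ Q x) + count R
count-overlap P Q R P⊆R Q⊆R = begin
  count P + count Q                                 ≡⟨ count-∧-∨ P Q ⟨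
  count (λ x → P x ∧ Q x) + count (λ x → P x ∨ Q x) ≤⟨ +-monoʳ-≤ _ (count-mono-≤ P∨Q⊆R) ⟩
  count (λ x → P x ∧ Q x) + count R                 ∎
  where
  open ≤-Reasoning
  P∨Q⊆R : ∀ x → T (P x ∨ Q x) → T (R x)
  P∨Q⊆R x P∨Q = [ P⊆R x , Q⊆R x ]′ (Equivalence.to T-∨ P∨Q)

count-xor : ∀ {n} (P Q : Fin n → Bool) →
  count (λ x → P x xor Q x) + count (λ x → P x ∧ Q x) + count (λ x → P x ∧ Q x)
    ≡ count P + count Q
count-xor {n} P Q = begin
  count (λ x → P x xor Q x) + count P∧Q + count P∧Q  ≡⟨ cong (_+ count P∧Q) xor+∧≡∨ ⟩
  count (λ x → P x ∨ Q x) + count P∧Q               ≡⟨ +-comm (count (λ x → P x ∨ Q x)) (count P∧Q) ⟩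
  count P∧Q + count (λ x → P x ∨ Q x)               ≡⟨ count-∧-∨ P Q ⟩
  count P + count Q                                 ∎
  where
  open ≡-Reasoning
  P∧Q : Fin n → Bool
  P∧Q x = P x ∧ Q x
  pointwise : ∀ a b → [ a xor b ] + [ a ∧ b ] ≡ [ a ∨ b ]
  pointwise true  true  = refl
  pointwise true  false = refl
  pointwise false true  = refl
  pointwise false false = refl
  xor+∧≡∨ : count (λ x → P x xor Q x) + count P∧Q ≡ count (λ x → P x ∨ Q x)
  xor+∧≡∨ = count-+ λ x → pointwise (P x) (Q x)

count-∧-false : ∀ {n} (P : Fin n → Bool) → count (λ x → P x ∧ false) ≡ 0
count-∧-false {n} P = trans (count-cong (∧-zeroʳ ∘ P)) (count-false {n})

count-const-∧ : ∀ {n} b (P : Fin n → Bool) → count (λ x → b ∧ P x) ≡ [ b ] * count P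
count-const-∧ true  P = sym (+-identityʳ _)
count-const-∧ {n} false P = count-false {n}

count-permute : ∀ {n} (P : Fin n → Bool) (σ τ : Fin n → Fin n) →
  (∀ y → σ (τ y) ≡ y) → (∀ x → τ (σ x) ≡ x) → count (P ∘ σ) ≡ count P
count-permute P σ τ στ τσ = sym (sum-permute (λ x → [ P x ]) (permutation σ τ στ τσ))

∑-const : ∀ {n} c → ∑[ x < n ] c ≡ n * c
∑-const {zero}  c = refl
∑-const {suc n} c = cong (λ s → c + s) (∑-const {n} c)

∑-mono-≤ : ∀ {n} {f g : Fin n → ℕ} → (∀ x → f x ≤ g x) → ∑[ x < n ] f x ≤ ∑[ x < n ] g x
∑-mono-≤ {zero}  _   = z≤n
∑-mono-≤ {suc n} f≤g = +-mono-≤ (f≤g zero) (∑-mono-≤ (f≤g ∘ suc))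

∣tabulate∣ : ∀ {n} (P : Fin n → Bool) → ∣ tabulate P ∣ ≡ count P
∣tabulate∣ {zero}  P = refl
∣tabulate∣ {suc n} P with P zero
... | true  = cong suc (∣tabulate∣ (P ∘ suc))
... | false = ∣tabulate∣ (P ∘ suc)

∈-tabulate⁺ : ∀ {n} (P : Fin n → Bool) {x} → T (P x) → x ∈ tabulate P
∈-tabulate⁺ P {x} Px = lookup⇒[]= x (tabulate P) (trans (lookup∘tabulate P x) (T⇒≡true Px))

∈-tabulate⁻ : ∀ {n} (P : Fin n → Bool) {x} → x ∈ tabulate P → T (P x)
∈-tabulate⁻ P {x} x∈P = Equivalence.from T-≡ (trans (sym (lookup∘tabulate P x)) ([]=⇒lookup x∈P))

-- Images of injections

image : ∀ {m n} → (Fin m → Fin n) → Fin n → Bool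
image f y = does (any? λ i → f i ≟ y)

missing : ∀ {m n} → (Fin m → Fin n) → Fin n → Bool
missing f y = not (image f y)

image⁻ : ∀ {m n} (f : Fin m → Fin n) {y} → T (image f y) → ∃ λ i → f i ≡ y
image⁻ f {y} y∈ with any? (λ i → f i ≟ y) | y∈
... | yes fi≡y | _ = fi≡y

missing⁻ : ∀ {m n} (f : Fin m → Fin n) {y} → T (missing f y) → ∀ i → f i ≢ y
missing⁻ f {y} y∉ i fi≡y with any? (λ i → f i ≟ y) | y∉
... | no ¬fi≡y | _ = ¬fi≡y (i , fi≡y)

≟⁻ : ∀ {n} {x y : Fin n} → T (does (x ≟ y)) → x ≡ y
≟⁻ {x = x} {y} x≡y with x ≟ y | x≡y
... | yes x≡y | _ = x≡y

count-∧-≟ : ∀ {n} (P : Fin n → Bool) x → count (λ y → P y ∧ does (x ≟ y)) ≡ [ P x ]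
count-∧-≟ {suc n} P zero = begin
  [ P zero ∧ true ] + count (λ y → P (suc y) ∧ false)
    ≡⟨ cong₂ _+_ (cong [_] (∧-identityʳ (P zero))) (count-∧-false (P ∘ suc)) ⟩
  [ P zero ] + 0
    ≡⟨ +-identityʳ [ P zero ] ⟩
  [ P zero ]
    ∎
  where open ≡-Reasoning
count-∧-≟ {suc n} P (suc x) =
  cong₂ _+_ (cong [_] (∧-zeroʳ (P zero))) (count-∧-≟ (P ∘ suc) x)

count-∧-image : ∀ {m n} (P : Fin n → Bool) (f : Fin m → Fin n) → Injective _≡_ _≡_ f →
  count (λ y → P y ∧ image f y) ≡ count (P ∘ f)
count-∧-image {zero} P f _ = count-∧-false P
count-∧-image {suc m} P f f-inj = begin
  count (λ y → P y ∧ (hit y ∨ image (f ∘ suc) y))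
    ≡⟨ count-cong (λ y → ∧-distribˡ-∨ (P y) _ _) ⟩
  count (λ y → (P y ∧ hit y) ∨ (P y ∧ image (f ∘ suc) y))
    ≡⟨ count-∨-disjoint _ _ disjoint ⟩
  count (λ y → P y ∧ hit y) + count (λ y → P y ∧ image (f ∘ suc) y)
    ≡⟨ cong₂ _+_ (count-∧-≟ P (f zero)) tail ⟩
  count (P ∘ f)
    ∎
  where
  open ≡-Reasoning
  hit : Fin _ → Bool
  hit y = does (f zero ≟ y)
  tail : count (λ y → P y ∧ image (f ∘ suc) y) ≡ count (P ∘ f ∘ suc)
  tail = count-∧-image P (f ∘ suc) (suc-injective ∘ f-inj)
  disjoint : ∀ y → T (P y ∧ hit y) → T (P y ∧ image (f ∘ suc) y) → ⊥
  disjoint y h t with (i , fi≡y) ← image⁻ (f ∘ suc) (proj₂ (T-∧⁻ t)) =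
    0≢1+n (f-inj (trans (≟⁻ (proj₂ (T-∧⁻ h))) (sym fi≡y)))

count-image : ∀ {m n} (f : Fin m → Fin n) → Injective _≡_ _≡_ f → count (image f) ≡ m
count-image f f-inj = trans (count-∧-image (λ _ → true) f f-inj) count-true

count-missing : ∀ {m n} (f : Fin m → Fin n) → Injective _≡_ _≡_ f → count (missing f) + m ≡ n
count-missing {m} {n} f f-inj = begin
  count (missing f) + m                ≡⟨ cong (λ c → count (missing f) + c) (count-image f f-inj) ⟨
  count (missing f) + count (image f)  ≡⟨ +-comm (count (missing f)) (count (image f)) ⟩
  count (image f) + count (missing f)  ≡⟨ count-not (image f) ⟩
  n                                    ∎
  where open ≡-Reasoning

count-∘-injective : ∀ {m n} (P : Fin n → Bool) (f : Fin m → Fin n) → Injective _≡_ _≡_ f →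
  ∀ v → (∀ y → T (missing f y) → P y ≡ v) → count (P ∘ f) + [ v ] * count (missing f) ≡ count P
count-∘-injective P f f-inj v P≡v = begin
  count (P ∘ f) + [ v ] * count (missing f)
    ≡⟨ cong₂ _+_ (count-∧-image P f f-inj) (count-const-∧ v (missing f)) ⟨
  count (λ y → P y ∧ image f y) + count (λ y → v ∧ missing f y)
    ≡⟨ cong (λ c → count (λ y → P y ∧ image f y) + c) (count-cong on-missing) ⟨
  count (λ y → P y ∧ image f y) + count (λ y → P y ∧ missing f y)
    ≡⟨ count-split P (image f) ⟩
  count P
    ∎
  where
  open ≡-Reasoning
  on-missing : ∀ y → P y ∧ missing f y ≡ v ∧ missing f y
  on-missing y with missing f y | P≡v y
  ... | true  | Py≡v = cong (_∧ true) (Py≡v _)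
  ... | false | _    = trans (∧-zeroʳ (P y)) (sym (∧-zeroʳ v))

cons-injective : ∀ {m n} {a : Fin n} {f : Fin m → Fin n} → (∀ i → f i ≢ a) →
  Injective _≡_ _≡_ f → Injective _≡_ _≡_ (a Vector.∷ f)
cons-injective a∉f f-inj {zero}  {zero}  _      = refl
cons-injective a∉f f-inj {zero}  {suc j} a≡fj  = ⊥-elim (a∉f j (sym a≡fj))
cons-injective a∉f f-inj {suc i} {zero}  fi≡a  = ⊥-elim (a∉f i fi≡a)
cons-injective a∉f f-inj {suc i} {suc j} fi≡fj = cong suc (f-inj fi≡fj)

-- Finite groups

module FiniteGroup {n : ℕ} (G : FinGroup n) where

  open FinGroup G public
  open IsGroup isGroup public using (assoc; inverseʳ)

  group : Group 0ℓ 0ℓ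
  group = record { Carrier = Fin n ; _≈_ = _≡_ ; _∙_ = _∙_ ; ε = ε ; _⁻¹ = _⁻¹ ; isGroup = isGroup }

  open GroupProperties group public
    using (⁻¹-involutive; ⁻¹-anti-homo-∙;
           \\-leftDividesˡ; \\-leftDividesʳ; //-rightDividesˡ; //-rightDividesʳ)

  count-∘-∙ˡ : ∀ g (P : Fin n → Bool) → count (λ x → P (g ∙ x)) ≡ count P
  count-∘-∙ˡ g P = count-permute P (g ∙_) (g ⁻¹ ∙_) (\\-leftDividesˡ g) (\\-leftDividesʳ g)

  count-∘-∙ʳ : ∀ g (P : Fin n → Bool) → count (λ x → P (x ∙ g)) ≡ count P
  count-∘-∙ʳ g P = count-permute P (_∙ g) (_∙ g ⁻¹) (//-rightDividesˡ g) (//-rightDividesʳ g)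

  count-∘-⁻¹ : ∀ (P : Fin n → Bool) → count (λ x → P (x ⁻¹)) ≡ count P
  count-∘-⁻¹ P = count-permute P (_⁻¹) (_⁻¹) ⁻¹-involutive ⁻¹-involutive

  meet : (Fin n → Bool) → Fin n → ℕ
  meet P g = count (λ x → P x ∧ P (g ∙ x))

  meet-⁻¹ : ∀ P g → meet P (g ⁻¹) ≡ meet P g
  meet-⁻¹ P g = begin
    meet P (g ⁻¹)
      ≡⟨ count-∘-∙ˡ g (λ x → P x ∧ P (g ⁻¹ ∙ x)) ⟨
    count (λ x → P (g ∙ x) ∧ P (g ⁻¹ ∙ (g ∙ x)))
      ≡⟨ count-cong (λ x → cong (λ y → P (g ∙ x) ∧ P y) (\\-leftDividesʳ g x)) ⟩
    count (λ x → P (g ∙ x) ∧ P x)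
      ≡⟨ count-cong (λ x → ∧-comm (P (g ∙ x)) (P x)) ⟩
    meet P g
      ∎
    where open ≡-Reasoning

  meet-∙ : ∀ P g h → meet P g + meet P h ≤ meet P (g ∙ h) + count P
  meet-∙ P g h = begin
    meet P g + meet P h
      ≡⟨ +-comm (meet P g) (meet P h) ⟩
    meet P h + meet P g
      ≡⟨ cong (λ c → meet P h + c) (count-∘-∙ˡ h (λ y → P y ∧ P (g ∙ y))) ⟨
    count U + count V
      ≤⟨ count-overlap U V (λ x → P (h ∙ x)) (λ _ → proj₂ ∘ T-∧⁻) (λ _ → proj₁ ∘ T-∧⁻) ⟩
    count (λ x → U x ∧ V x) + count (λ x → P (h ∙ x))
      ≤⟨ +-mono-≤ (count-mono-≤ U∧V⊆) (≤-reflexive (count-∘-∙ˡ h P)) ⟩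
    meet P (g ∙ h) + count P
      ∎
    where
    open ≤-Reasoning
    U V : Fin n → Bool
    U x = P x ∧ P (h ∙ x)
    V x = P (h ∙ x) ∧ P (g ∙ (h ∙ x))
    U∧V⊆ : ∀ x → T (U x ∧ V x) → T (P x ∧ P (g ∙ h ∙ x))
    U∧V⊆ x U∧V with Ux , Vx ← T-∧⁻ U∧V =
      T-∧⁺ (proj₁ (T-∧⁻ Ux)) (subst (T ∘ P) (sym (assoc g h x)) (proj₂ (T-∧⁻ Vx)))

  0<meet⇒∃ : ∀ P g → 0 < meet P g → ∃ λ x → T (P x) × T (P (g ∙ x))
  0<meet⇒∃ P g pos with x , Px∧Pgx ← 0<count⇒∃ pos = x , T-∧⁻ Px∧Pgx

  ∃⇒0<meet : ∀ P {x y} → T (P x) → T (P y) → 0 < meet P (y ∙ x ⁻¹)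
  ∃⇒0<meet P {x} {y} Px Py =
    ∃⇒0<count x (T-∧⁺ Px (subst (T ∘ P) (sym (//-rightDividesˡ x y)) Py))

  ∑-meet : ∀ P → ∑[ g < n ] meet P g ≡ count P * count P
  ∑-meet P = begin
    ∑[ g < n ] ∑[ x < n ] [ P x ∧ P (g ∙ x) ]  ≡⟨ ∑-comm (λ g x → [ P x ∧ P (g ∙ x) ]) ⟩
    ∑[ x < n ] count (λ g → P x ∧ P (g ∙ x))   ≡⟨ sum-cong-≗ column ⟩
    ∑[ x < n ] ([ P x ] * count P)             ≡⟨ *-distribʳ-sum (count P) (λ x → [ P x ]) ⟨
    count P * count P                          ∎
    where
    open ≡-Reasoning
    column : ∀ x → count (λ g → P x ∧ P (g ∙ x)) ≡ [ P x ] * count P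
    column x = trans (count-const-∧ (P x) (λ g → P (g ∙ x))) (cong ([ P x ] *_) (count-∘-∙ʳ x P))

  translates-meet : ∀ P W g h →
    (∀ x → T (P (g ∙ x)) → T (W x)) → (∀ x → T (P (h ∙ x)) → T (W x)) →
    count P + count P ≤ meet P (h ∙ g ⁻¹) + count W
  translates-meet P W g h gP⊆W hP⊆W = begin
    count P + count P                                  ≡⟨ cong₂ _+_ (count-∘-∙ˡ g P) (count-∘-∙ˡ h P) ⟨
    count (λ x → P (g ∙ x)) + count (λ x → P (h ∙ x))  ≤⟨ count-overlap _ _ W gP⊆W hP⊆W ⟩
    count (λ x → P (g ∙ x) ∧ P (h ∙ x)) + count W      ≡⟨ cong (_+ count W) common ⟩
    meet P (h ∙ g ⁻¹) + count W                        ∎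
    where
    open ≤-Reasoning
    common : count (λ x → P (g ∙ x) ∧ P (h ∙ x)) ≡ meet P (h ∙ g ⁻¹)
    common = begin-equality
      count (λ x → P (g ∙ x) ∧ P (h ∙ x))
        ≡⟨ count-∘-∙ˡ (g ⁻¹) _ ⟨
      count (λ y → P (g ∙ (g ⁻¹ ∙ y)) ∧ P (h ∙ (g ⁻¹ ∙ y)))
        ≡⟨ count-cong (λ y → cong₂ (λ u v → P u ∧ P v) (\\-leftDividesˡ g y) (sym (assoc h (g ⁻¹) y))) ⟩
      meet P (h ∙ g ⁻¹)
        ∎

  module IndexTwo (H : Fin n → Bool)
    (∙-closed : ∀ {x y} → T (H x) → T (H y) → T (H (x ∙ y)))
    (⁻¹-closed : ∀ {x} → T (H x) → T (H (x ⁻¹)))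
    (large : n < 3 * count H) where

    ⁻¹-closed⁻ : ∀ {x} → T (H (x ⁻¹)) → T (H x)
    ⁻¹-closed⁻ {x} x⁻¹∈H = subst (T ∘ H) (⁻¹-involutive x) (⁻¹-closed x⁻¹∈H)

    H∩uH⇒u∈H : ∀ {u} x → T (H x) → T (H (u ⁻¹ ∙ x)) → T (H u)
    H∩uH⇒u∈H {u} x x∈H u⁻¹x∈H =
      ⁻¹-closed⁻ (subst (T ∘ H) (//-rightDividesʳ x (u ⁻¹)) (∙-closed u⁻¹x∈H (⁻¹-closed x∈H)))

    uH∩vH⇒u⁻¹v∈H : ∀ {u v} x → T (H (u ⁻¹ ∙ x)) → T (H (v ⁻¹ ∙ x)) → T (H (u ⁻¹ ∙ v))
    uH∩vH⇒u⁻¹v∈H {u} {v} x u⁻¹x∈H v⁻¹x∈H =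
      subst (T ∘ H) quotient (∙-closed u⁻¹x∈H (⁻¹-closed v⁻¹x∈H))
      where
      open ≡-Reasoning
      quotient : (u ⁻¹ ∙ x) ∙ (v ⁻¹ ∙ x) ⁻¹ ≡ u ⁻¹ ∙ v
      quotient = begin
        (u ⁻¹ ∙ x) ∙ (v ⁻¹ ∙ x) ⁻¹     ≡⟨ cong ((u ⁻¹ ∙ x) ∙_) (⁻¹-anti-homo-∙ (v ⁻¹) x) ⟩
        (u ⁻¹ ∙ x) ∙ (x ⁻¹ ∙ v ⁻¹ ⁻¹)  ≡⟨ cong (λ w → (u ⁻¹ ∙ x) ∙ (x ⁻¹ ∙ w)) (⁻¹-involutive v) ⟩
        (u ⁻¹ ∙ x) ∙ (x ⁻¹ ∙ v)        ≡⟨ assoc (u ⁻¹) x (x ⁻¹ ∙ v) ⟩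
        u ⁻¹ ∙ (x ∙ (x ⁻¹ ∙ v))        ≡⟨ cong (u ⁻¹ ∙_) (\\-leftDividesˡ x v) ⟩
        u ⁻¹ ∙ v                       ∎

    three-cosets-≤ : ∀ {u v} → ¬ T (H u) → ¬ T (H v) → ¬ T (H (u ⁻¹ ∙ v)) → 3 * count H ≤ n
    three-cosets-≤ {u} {v} u∉H v∉H u⁻¹v∉H = begin
      3 * count H
        ≡⟨ cong (λ c → count H + (count H + c)) (+-identityʳ (count H)) ⟩
      count H + (count H + count H)
        ≡⟨ +-assoc (count H) (count H) (count H) ⟨
      count H + count H + count H
        ≡⟨ cong₂ (λ a b → count H + a + b) (count-∘-∙ˡ (u ⁻¹) H) (count-∘-∙ˡ (v ⁻¹) H) ⟨
      count H + count uH + count vH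
        ≡⟨ cong (_+ count vH) (count-∨-disjoint H uH (λ x x∈H → u∉H ∘ H∩uH⇒u∈H x x∈H)) ⟨
      count (λ x → H x ∨ uH x) + count vH
        ≡⟨ count-∨-disjoint (λ x → H x ∨ uH x) vH disjoint ⟨
      count (λ x → (H x ∨ uH x) ∨ vH x)
        ≤⟨ count≤n ⟩
      n ∎
      where
      open ≤-Reasoning
      uH vH : Fin n → Bool
      uH x = H (u ⁻¹ ∙ x)
      vH x = H (v ⁻¹ ∙ x)
      disjoint : ∀ x → T (H x ∨ uH x) → T (vH x) → ⊥
      disjoint x x∈H∪uH x∈vH with Equivalence.to T-∨ x∈H∪uH
      ... | inj₁ x∈H  = v∉H (H∩uH⇒u∈H x x∈H x∈vH)
      ... | inj₂ x∈uH = u⁻¹v∉H (uH∩vH⇒u⁻¹v∈H x x∈uH x∈vH)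

    outside⁻¹∙outside : ∀ {u v} → ¬ T (H u) → ¬ T (H v) → T (H (u ⁻¹ ∙ v))
    outside⁻¹∙outside u∉H v∉H = decidable-stable (T? _) (<⇒≱ large ∘ three-cosets-≤ u∉H v∉H)

    count-H+count-H : ∀ {y} → ¬ T (H y) → count H + count H ≡ n
    count-H+count-H {y} y∉H = begin
      count H + count H                       ≡⟨ cong (λ c → count H + c) (count-∘-∙ˡ (y ⁻¹) H) ⟨
      count H + count yH                      ≡⟨ count-∨-disjoint H yH disjoint ⟨
      count (λ x → H x ∨ yH x)                ≡⟨ count-all covers ⟩
      n                                       ∎
      where
      open ≡-Reasoning
      yH : Fin n → Bool
      yH x = H (y ⁻¹ ∙ x)
      disjoint : ∀ x → T (H x) → T (yH x) → ⊥
      disjoint x x∈H = y∉H ∘ H∩uH⇒u∈H x x∈H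
      covers : ∀ x → T (H x ∨ yH x)
      covers x with T? (H x)
      ... | yes x∈H = Equivalence.from T-∨ (inj₁ x∈H)
      ... | no  x∉H = Equivalence.from T-∨ (inj₂ (outside⁻¹∙outside y∉H x∉H))

    parity : Fin n → Bool
    parity x = not (H x)

    parity-∙ : ∀ x y → parity (x ∙ y) ≡ parity x xor parity y
    parity-∙ x y with T? (H x) | T? (H y)
    ... | yes x∈H | yes y∈H
      rewrite T⇒≡true x∈H | T⇒≡true y∈H | T⇒≡true (∙-closed x∈H y∈H) = refl
    ... | yes x∈H | no y∉H
      rewrite T⇒≡true x∈H | ¬T⇒≡false y∉H
            | ¬T⇒≡false (y∉H ∘ subst (T ∘ H) (\\-leftDividesʳ x y) ∘ ∙-closed (⁻¹-closed x∈H)) = refl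
    ... | no x∉H | yes y∈H
      rewrite ¬T⇒≡false x∉H | T⇒≡true y∈H
            | ¬T⇒≡false (x∉H ∘ subst (T ∘ H) (//-rightDividesʳ y x) ∘ flip ∙-closed (⁻¹-closed y∈H)) = refl
    ... | no x∉H | no y∉H
      rewrite ¬T⇒≡false x∉H | ¬T⇒≡false y∉H
            | T⇒≡true (subst (λ z → T (H (z ∙ y))) (⁻¹-involutive x)
                             (outside⁻¹∙outside (x∉H ∘ ⁻¹-closed⁻) y∉H)) = refl

    parity-⁻¹ : ∀ x → parity (x ⁻¹) ≡ parity x
    parity-⁻¹ x with T? (H x)
    ... | yes x∈H rewrite T⇒≡true x∈H | T⇒≡true (⁻¹-closed x∈H) = refl
    ... | no  x∉H rewrite ¬T⇒≡false x∉H | ¬T⇒≡false (x∉H ∘ ⁻¹-closed⁻) = refl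

    coset⇒parity≡ : ∀ {x y} → T (H (x ∙ y ⁻¹)) → parity x ≡ parity y
    coset⇒parity≡ {x} {y} xy⁻¹∈H = begin
      parity x                          ≡⟨ cong parity (//-rightDividesˡ y x) ⟨
      parity (x ∙ y ⁻¹ ∙ y)             ≡⟨ parity-∙ (x ∙ y ⁻¹) y ⟩
      parity (x ∙ y ⁻¹) xor parity y    ≡⟨ cong (λ b → not b xor parity y) (T⇒≡true xy⁻¹∈H) ⟩
      parity y                          ∎
      where open ≡-Reasoning

    parity≡⇒coset : ∀ {x y} → parity x ≡ parity y → T (H (x ∙ y ⁻¹))
    parity≡⇒coset {x} {y} px≡py = Equivalence.from T-≡ (not-injective (begin
      parity (x ∙ y ⁻¹)                 ≡⟨ parity-∙ x (y ⁻¹) ⟩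
      parity x xor parity (y ⁻¹)        ≡⟨ cong₂ _xor_ px≡py (parity-⁻¹ y) ⟩
      parity y xor parity y             ≡⟨ xor-same (parity y) ⟩
      false                             ∎))
      where open ≡-Reasoning

    count-parity : ∀ {y} → ¬ T (H y) → count parity ≡ count H
    count-parity y∉H =
      +-cancelˡ-≡ (count H) (count parity) (count H) (trans (count-not H) (sym (count-H+count-H y∉H)))

  tabulate-isSubgroup : ∀ (H : Fin n → Bool) → T (H ε) →
    (∀ {x y} → T (H x) → T (H y) → T (H (x ∙ y))) → (∀ {x} → T (H x) → T (H (x ⁻¹))) →
    IsSubgroup G (tabulate H)
  tabulate-isSubgroup H ε∈H ∙-closed ⁻¹-closed = record
    { ε∈  = ∈-tabulate⁺ H ε∈H
    ; ∙∈  = λ x∈H y∈H → ∈-tabulate⁺ H (∙-closed (∈-tabulate⁻ H x∈H) (∈-tabulate⁻ H y∈H))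
    ; ⁻¹∈ = ∈-tabulate⁺ H ∘ ⁻¹-closed ∘ ∈-tabulate⁻ H
    }

-- Maximal partial transversals

module MaximalTransversal {n ℓ : ℕ} {G : FinGroup n}
  (𝒯 : PartialTransversal G ℓ) (maximal : Maximal G 𝒯) where

  open FiniteGroup G
  open PartialTransversal 𝒯

  symbol : Fin ℓ → Fin n
  symbol i = row i ∙ col i

  A B C : Fin n → Bool
  A = missing row
  B = missing col
  C = missing symbol

  k : ℕ
  k = count A

  k+ℓ≡n : k + ℓ ≡ n
  k+ℓ≡n = count-missing row rowInj

  count-B : count B ≡ k
  count-B = +-cancelʳ-≡ ℓ (count B) k (trans (count-missing col colInj) (sym k+ℓ≡n))

  count-C : count C ≡ k
  count-C = +-cancelʳ-≡ ℓ (count C) k (trans (count-missing symbol symInj) (sym k+ℓ≡n))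

  unextendable : ∀ {a b} → T (A a) → T (B b) → ¬ T (C (a ∙ b))
  unextendable {a} {b} a∈A b∈B ab∈C =
    maximal (suc ℓ) extension (n<1+n ℓ) (λ i → suc i , refl , refl)
    where
    cons-∙ : ∀ i → (a Vector.∷ row) i ∙ (b Vector.∷ col) i ≡ (a ∙ b Vector.∷ symbol) i
    cons-∙ zero    = refl
    cons-∙ (suc i) = refl
    extension : PartialTransversal G (suc ℓ)
    extension = record
      { row    = a Vector.∷ row
      ; col    = b Vector.∷ col
      ; rowInj = cons-injective (missing⁻ row a∈A) rowInj
      ; colInj = cons-injective (missing⁻ col b∈B) colInj
      ; symInj = λ {i} {j} eq → cons-injective (missing⁻ symbol ab∈C) symInj
                                   (trans (sym (cons-∙ i)) (trans eq (cons-∙ j)))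
      }

  column-covered : ∀ {a b} → T (A a) → T (C (a ∙ b)) → T (image col b)
  column-covered a∈A ab∈C =
    decidable-stable (T? _) λ b∉ → unextendable a∈A (Equivalence.from T-not-≡ (¬T⇒≡false b∉)) ab∈C

  5ℓ<3n⇒2ℓ<3k : 5 * ℓ < 3 * n → 2 * ℓ < 3 * k
  5ℓ<3n⇒2ℓ<3k 5ℓ<3n = +-cancelˡ-< (3 * ℓ) (2 * ℓ) (3 * k) (begin-strict
    3 * ℓ + 2 * ℓ  ≡⟨ *-distribʳ-+ ℓ 3 2 ⟨
    5 * ℓ          <⟨ 5ℓ<3n ⟩
    3 * n          ≡⟨ cong (3 *_) k+ℓ≡n ⟨
    3 * (k + ℓ)    ≡⟨ *-distribˡ-+ 3 k ℓ ⟩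
    3 * k + 3 * ℓ  ≡⟨ +-comm (3 * k) (3 * ℓ) ⟩
    3 * ℓ + 3 * k  ∎)
    where open ≤-Reasoning

  -- Two translates of a k-set inside an ℓ-set meet in at least 2k - ℓ points.
  Dense : (Fin n → Bool) → Fin n → Set
  Dense P g = k + k ≤ meet P g + ℓ

  A-meets⇒C-dense : ∀ {g} → 0 < meet A g → Dense C g
  A-meets⇒C-dense {g} pos with x , x∈A , gx∈A ← 0<meet⇒∃ A g pos = begin
    k + k
      ≡⟨ cong₂ _+_ count-C count-C ⟨
    count C + count C
      ≤⟨ translates-meet C (image col) x (g ∙ x) (λ _ → column-covered x∈A) (λ _ → column-covered gx∈A) ⟩
    meet C (g ∙ x ∙ x ⁻¹) + count (image col)
      ≡⟨ cong₂ _+_ (cong (meet C) (//-rightDividesʳ x g)) (count-image col colInj) ⟩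
    meet C g + ℓ
      ∎
    where open ≤-Reasoning

  C-meets⇒A-dense : ∀ {g} → 0 < meet C g → Dense A g
  C-meets⇒A-dense {g} pos with x , x∈C , gx∈C ← 0<meet⇒∃ C g pos = begin
    k + k
      ≤⟨ translates-meet A W x (g ∙ x) (covered x∈C) (covered gx∈C) ⟩
    meet A (g ∙ x ∙ x ⁻¹) + count W
      ≡⟨ cong₂ _+_ (cong (meet A) (//-rightDividesʳ x g)) count-W ⟩
    meet A g + ℓ
      ∎
    where
    open ≤-Reasoning
    W : Fin n → Bool
    W y = image col (y ⁻¹)
    count-W : count W ≡ ℓ
    count-W = trans (count-∘-⁻¹ (image col)) (count-image col colInj)
    covered : ∀ {c} → T (C c) → ∀ y → T (A (c ∙ y)) → T (W y)
    covered {c} c∈C y cy∈A = column-covered cy∈A (subst (T ∘ C) (sym (//-rightDividesʳ y c)) c∈C)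

  module Short (short : 2 * ℓ < 3 * k) where

    0<k : 0 < k
    0<k = n≢0⇒n>0 λ k≡0 → n≮0 (subst (λ c → 2 * ℓ < 3 * c) k≡0 short)

    ℓ<k+k : ℓ < k + k
    ℓ<k+k = *-cancelˡ-< 2 ℓ (k + k) (<-≤-trans short (3k≤2[k+k] k))
      where
      3k≤2[k+k] : ∀ k → 3 * k ≤ 2 * (k + k)
      3k≤2[k+k] k = begin
        3 * k        ≤⟨ *-monoˡ-≤ k (n≤1+n 3) ⟩
        4 * k        ≡⟨ solve (k ∷ []) ⟩
        2 * (k + k)  ∎
        where open ≤-Reasoning

    dense⇒meets : ∀ {P g} → Dense P g → 0 < meet P g
    dense⇒meets {P} {g} dense with meet P g
    ... | zero  = ⊥-elim (<⇒≱ ℓ<k+k dense)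
    ... | suc _ = z<s

    dense-∙ : ∀ {g h} → Dense C g → Dense C h → 0 < meet C (g ∙ h)
    dense-∙ {g} {h} dense-g dense-h =
      positive {k} {ℓ} {meet C g} {meet C h} {meet C (g ∙ h)} short dense-g dense-h
        (subst (λ c → meet C g + meet C h ≤ meet C (g ∙ h) + c) count-C (meet-∙ C g h))
      where
      positive : ∀ {k ℓ x y z} →
        2 * ℓ < 3 * k → k + k ≤ x + ℓ → k + k ≤ y + ℓ → x + y ≤ z + k → 0 < z
      positive {z = suc _} _ _ _ _ = z<s
      positive {k} {ℓ} {x} {y} {zero} 2ℓ<3k k+k≤x+ℓ k+k≤y+ℓ x+y≤k =
        ⊥-elim (<⇒≱ 2ℓ<3k (+-cancelʳ-≤ k _ _ (begin
        3 * k + k                   ≡⟨ solve (k ∷ []) ⟩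
        (k + k) + (k + k)           ≤⟨ +-mono-≤ k+k≤x+ℓ k+k≤y+ℓ ⟩
        (x + ℓ) + (y + ℓ)           ≡⟨ solve (x ∷ y ∷ ℓ ∷ []) ⟩
        (x + y) + 2 * ℓ             ≤⟨ +-monoˡ-≤ (2 * ℓ) x+y≤k ⟩
        k + 2 * ℓ                   ≡⟨ +-comm k (2 * ℓ) ⟩
        2 * ℓ + k                   ∎)))
        where open ≤-Reasoning

    -- H = AA⁻¹
    H : Fin n → Bool
    H g = 0 <ᵇ meet A g

    H⁺ : ∀ {g} → 0 < meet A g → T (H g)
    H⁺ = <⇒<ᵇ

    H⁻ : ∀ {g} → T (H g) → 0 < meet A g
    H⁻ {g} = <ᵇ⇒< 0 (meet A g)

    H⇒A-dense : ∀ {g} → T (H g) → Dense A g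
    H⇒A-dense {g} = C-meets⇒A-dense ∘ dense⇒meets {C} {g} ∘ A-meets⇒C-dense ∘ H⁻

    H-∙ : ∀ {g h} → T (H g) → T (H h) → T (H (g ∙ h))
    H-∙ {g} {h} g∈H h∈H = H⁺ (dense⇒meets {A} {g ∙ h} (C-meets⇒A-dense
      (dense-∙ (A-meets⇒C-dense (H⁻ g∈H)) (A-meets⇒C-dense (H⁻ h∈H)))))

    H-⁻¹ : ∀ {g} → T (H g) → T (H (g ⁻¹))
    H-⁻¹ {g} g∈H = H⁺ (subst (0 <_) (sym (meet-⁻¹ A g)) (H⁻ g∈H))

    a₀ : Fin n
    a₀ = proj₁ (0<count⇒∃ {P = A} 0<k)

    a₀∈A : T (A a₀)
    a₀∈A = proj₂ (0<count⇒∃ {P = A} 0<k)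

    H-ε : T (H ε)
    H-ε = H⁺ (subst (λ g → 0 < meet A g) (inverseʳ a₀) (∃⇒0<meet A a₀∈A a₀∈A))

    k≤count-H : k ≤ count H
    k≤count-H = begin
      k                          ≡⟨ count-∘-∙ʳ a₀ A ⟨
      count (λ g → A (g ∙ a₀))   ≤⟨ count-mono-≤ Aa₀⁻¹⊆H ⟩
      count H                    ∎
      where
      open ≤-Reasoning
      Aa₀⁻¹⊆H : ∀ g → T (A (g ∙ a₀)) → T (H g)
      Aa₀⁻¹⊆H g ga₀∈A = H⁺ (subst (λ h → 0 < meet A h) (//-rightDividesʳ a₀ g) (∃⇒0<meet A a₀∈A ga₀∈A))

    large : n < 3 * count H
    large = begin-strict
      n              ≡⟨ k+ℓ≡n ⟨
      k + ℓ          <⟨ +-monoʳ-< k ℓ<k+k ⟩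
      k + (k + k)    ≡⟨ cong (λ c → k + (k + c)) (+-identityʳ k) ⟨
      3 * k          ≤⟨ *-monoʳ-≤ 3 k≤count-H ⟩
      3 * count H    ∎
      where open ≤-Reasoning

    H-proper : ∃ λ y → ¬ T (H y)
    H-proper = ¬∀⟶∃¬ n (T ∘ H) (T? ∘ H) λ all → quadratic short 0<k ℓ<k+k (begin
      (k + ℓ) * (k + k)                    ≡⟨ cong (_* (k + k)) k+ℓ≡n ⟩
      n * (k + k)                          ≡⟨ ∑-const {n} (k + k) ⟨
      ∑[ g < n ] (k + k)                   ≤⟨ ∑-mono-≤ (λ g → H⇒A-dense (all g)) ⟩
      ∑[ g < n ] (meet A g + ℓ)            ≡⟨ ∑-distrib-+ (meet A) (λ _ → ℓ) ⟩
      ∑[ g < n ] meet A g + ∑[ g < n ] ℓ   ≡⟨ cong₂ _+_ (∑-meet A) (∑-const {n} ℓ) ⟩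
      k * k + n * ℓ                        ≡⟨ cong (λ c → k * k + c * ℓ) k+ℓ≡n ⟨
      k * k + (k + ℓ) * ℓ                  ∎)
      where
      open ≤-Reasoning
      quadratic : ∀ {k ℓ} → 2 * ℓ < 3 * k → 0 < k → ℓ < k + k →
        ¬ ((k + ℓ) * (k + k) ≤ k * k + (k + ℓ) * ℓ)
      quadratic {k} {ℓ} 2ℓ<3k 0<k ℓ<k+k too-few = <-irrefl refl (begin-strict
        4 * (ℓ * ℓ)                      ≡⟨ solve (ℓ ∷ []) ⟩
        (2 * ℓ) * (2 * ℓ)                ≤⟨ *-monoˡ-≤ (2 * ℓ) (<⇒≤ 2ℓ<3k) ⟩
        (3 * k) * (2 * ℓ)                ≡⟨ solve (k ∷ ℓ ∷ []) ⟩
        4 * (k * ℓ) + 2 * (k * ℓ)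
          <⟨ +-monoʳ-< (4 * (k * ℓ)) (*-monoʳ-< 2 (*-monoʳ-< k {{>-nonZero 0<k}} ℓ<k+k)) ⟩
        4 * (k * ℓ) + 2 * (k * (k + k))  ≡⟨ solve (k ∷ ℓ ∷ []) ⟩
        4 * (k * k + k * ℓ)              ≤⟨ *-monoʳ-≤ 4 k²+kℓ≤ℓ² ⟩
        4 * (ℓ * ℓ)                      ∎)
        where
        k²+kℓ≤ℓ² : k * k + k * ℓ ≤ ℓ * ℓ
        k²+kℓ≤ℓ² = +-cancelˡ-≤ (k * k + k * ℓ) _ _ (begin
          (k * k + k * ℓ) + (k * k + k * ℓ) ≡⟨ solve (k ∷ ℓ ∷ []) ⟩
          (k + ℓ) * (k + k)                 ≤⟨ too-few ⟩
          k * k + (k + ℓ) * ℓ               ≡⟨ solve (k ∷ ℓ ∷ []) ⟩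
          (k * k + k * ℓ) + ℓ * ℓ           ∎)

    open IndexTwo H H-∙ H-⁻¹ large

    index-two : count H + count H ≡ n
    index-two = count-H+count-H (proj₂ H-proper)

    c₀ : Fin n
    c₀ = proj₁ (0<count⇒∃ {P = C} (subst (0 <_) (sym count-C) 0<k))

    c₀∈C : T (C c₀)
    c₀∈C = proj₂ (0<count⇒∃ {P = C} (subst (0 <_) (sym count-C) 0<k))

    parity-A : ∀ {a} → T (A a) → parity a ≡ parity a₀
    parity-A a∈A = coset⇒parity≡ (H⁺ (∃⇒0<meet A a₀∈A a∈A))

    parity-C : ∀ {c} → T (C c) → parity c ≡ parity c₀
    parity-C {c} c∈C =
      coset⇒parity≡ (H⁺ (dense⇒meets {A} {c ∙ c₀ ⁻¹} (C-meets⇒A-dense (∃⇒0<meet C c₀∈C c∈C))))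

    parity-Ab : ∀ {g b} → T (A (g ∙ b ⁻¹)) → parity g ≡ parity (a₀ ∙ b)
    parity-Ab {g} {b} gb⁻¹∈A = begin
      parity g                         ≡⟨ cong parity (//-rightDividesˡ b g) ⟨
      parity (g ∙ b ⁻¹ ∙ b)            ≡⟨ parity-∙ (g ∙ b ⁻¹) b ⟩
      parity (g ∙ b ⁻¹) xor parity b   ≡⟨ cong (_xor parity b) (parity-A gb⁻¹∈A) ⟩
      parity a₀ xor parity b           ≡⟨ parity-∙ a₀ b ⟨
      parity (a₀ ∙ b)                  ∎
      where open ≡-Reasoning

    parity-a₀b≢parity-c₀ : ∀ {b} → T (B b) → parity (a₀ ∙ b) ≢ parity c₀
    parity-a₀b≢parity-c₀ {b} b∈B same =
      too-many {k} {ℓ} {count H} short (trans index-two (sym k+ℓ≡n)) (begin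
        k + k                          ≡⟨ cong₂ _+_ (count-∘-∙ʳ (b ⁻¹) A) count-C ⟨
        count Ab + count C             ≡⟨ count-∨-disjoint Ab C disjoint ⟨
        count (λ g → Ab g ∨ C g)       ≤⟨ count-mono-≤ ⊆Hc₀ ⟩
        count (λ g → H (g ∙ c₀ ⁻¹))    ≡⟨ count-∘-∙ʳ (c₀ ⁻¹) H ⟩
        count H                        ∎)
      where
      open ≤-Reasoning
      Ab : Fin n → Bool
      Ab g = A (g ∙ b ⁻¹)
      disjoint : ∀ g → T (Ab g) → T (C g) → ⊥
      disjoint g gb⁻¹∈A g∈C =
        unextendable gb⁻¹∈A b∈B (subst (T ∘ C) (sym (//-rightDividesˡ b g)) g∈C)
      ⊆Hc₀ : ∀ g → T (Ab g ∨ C g) → T (H (g ∙ c₀ ⁻¹))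
      ⊆Hc₀ g g∈Ab∪C with Equivalence.to T-∨ g∈Ab∪C
      ... | inj₂ g∈C    = parity≡⇒coset (parity-C g∈C)
      ... | inj₁ gb⁻¹∈A = parity≡⇒coset (trans (parity-Ab gb⁻¹∈A) same)
      too-many : ∀ {k ℓ m} → 2 * ℓ < 3 * k → m + m ≡ k + ℓ → k + k ≤ m → ⊥
      too-many {k} {ℓ} {m} 2ℓ<3k m+m≡k+ℓ k+k≤m = <⇒≱ (<-≤-trans 2ℓ<3k 3k≤ℓ) (m≤m+n ℓ (ℓ + 0))
        where
        3k≤ℓ : 3 * k ≤ ℓ
        3k≤ℓ = +-cancelʳ-≤ k (3 * k) ℓ (begin
          3 * k + k          ≡⟨ solve (k ∷ []) ⟩
          (k + k) + (k + k)  ≤⟨ +-mono-≤ k+k≤m k+k≤m ⟩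
          m + m              ≡⟨ m+m≡k+ℓ ⟩
          k + ℓ              ≡⟨ +-comm k ℓ ⟩
          ℓ + k              ∎)

    parity-B : ∀ {b} → T (B b) → parity b ≡ not (parity a₀ xor parity c₀)
    parity-B {b} b∈B =
      xor-≢ (parity a₀) (parity c₀) (parity-a₀b≢parity-c₀ b∈B ∘ trans (parity-∙ a₀ b))
      where
      xor-≢ : ∀ a {b} c → a xor b ≢ c → b ≡ not (a xor c)
      xor-≢ false c a⊕b≢c = ¬-not a⊕b≢c
      xor-≢ true  c a⊕b≢c = trans (not-injective (¬-not a⊕b≢c)) (sym (not-involutive c))

    parity-count : ∀ (f : Fin ℓ → Fin n) → Injective _≡_ _≡_ f → count (missing f) ≡ k →
      ∀ v → (∀ y → T (missing f y) → parity y ≡ v) → count (parity ∘ f) + [ v ] * k ≡ count H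
    parity-count f f-inj count-f v parity≡v = begin
      count (parity ∘ f) + [ v ] * k
        ≡⟨ cong (λ c → count (parity ∘ f) + [ v ] * c) count-f ⟨
      count (parity ∘ f) + [ v ] * count (missing f)
        ≡⟨ count-∘-injective parity f f-inj v parity≡v ⟩
      count parity
        ≡⟨ count-parity (proj₂ H-proper) ⟩
      count H
        ∎
      where open ≡-Reasoning

    ℓ+∣H∣-even : ∃ λ N → ℓ + count H ≡ 2 * N
    ℓ+∣H∣-even = S + t + [ parity a₀ ∧ parity c₀ ] * k ,
      parity-sum {k} {ℓ} {count H} {R} {Q} {S} {t} {[ parity a₀ ]} {[ not (parity a₀ xor parity c₀) ]}
        {[ parity c₀ ]} {[ parity a₀ ∧ parity c₀ ]}
      (parity-count row rowInj refl (parity a₀) (λ _ → parity-A))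
      (parity-count col colInj count-B (not (parity a₀ xor parity c₀)) (λ _ → parity-B))
      (parity-count symbol symInj count-C (parity c₀) (λ _ → parity-C))
      (trans (cong (λ c → c + t + t) (count-cong (λ i → parity-∙ (row i) (col i))))
             (count-xor (parity ∘ row) (parity ∘ col)))
      (odd (parity a₀) (parity c₀))
      (trans k+ℓ≡n (sym index-two))
      where
      R Q S t : ℕ
      R = count (parity ∘ row)
      Q = count (parity ∘ col)
      S = count (parity ∘ symbol)
      t = count (λ i → parity (row i) ∧ parity (col i))
      odd : ∀ a c → [ a ] + [ not (a xor c) ] + [ c ] ≡ 1 + 2 * [ a ∧ c ]
      odd false false = refl
      odd false true  = refl
      odd true  false = refl
      odd true  true  = refl
      parity-sum : ∀ {k ℓ m R Q S t a b c e} →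
        R + a * k ≡ m → Q + b * k ≡ m → S + c * k ≡ m → S + t + t ≡ R + Q →
        a + b + c ≡ 1 + 2 * e → k + ℓ ≡ m + m → ℓ + m ≡ 2 * (S + t + e * k)
      parity-sum {k} {ℓ} {m} {R} {Q} {S} {t} {a} {b} {c} {e} eR eQ eS eX odd k+ℓ≡m+m =
        sym (+-cancelʳ-≡ k _ _ (begin
          2 * (S + t + e * k) + k                  ≡⟨ solve (S ∷ t ∷ e ∷ k ∷ []) ⟩
          S + (S + t + t) + (1 + 2 * e) * k        ≡⟨ cong₂ (λ u v → S + u + v * k) eX (sym odd) ⟩
          S + (R + Q) + (a + b + c) * k            ≡⟨ solve (S ∷ R ∷ Q ∷ a ∷ b ∷ c ∷ k ∷ []) ⟩
          (R + a * k) + (Q + b * k) + (S + c * k)  ≡⟨ cong₂ _+_ (cong₂ _+_ eR eQ) eS ⟩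
          m + m + m                                ≡⟨ cong (_+ m) k+ℓ≡m+m ⟨
          k + ℓ + m                                ≡⟨ solve (k ∷ ℓ ∷ m ∷ []) ⟩
          ℓ + m + k                                ∎))
        where open ≡-Reasoning

even-sum⇒even-difference : ∀ {ℓ m N} → ℓ + m ≡ 2 * N → + ℓ - + m ≡ + 2 ℤ.* (+ N - + m)
even-sum⇒even-difference {ℓ} {m} {N} ℓ+m≡2N = begin
  + ℓ - + m
    ≡⟨ shift (+ ℓ) (+ m) ⟩
  (+ ℓ ℤ.+ + m) - + 2 ℤ.* + m
    ≡⟨ cong (λ z → z - + 2 ℤ.* + m) (trans (cong +_ ℓ+m≡2N) (ℤ.pos-* 2 N)) ⟩
  + 2 ℤ.* + N - + 2 ℤ.* + m
    ≡⟨ factor (+ N) (+ m) ⟩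
  + 2 ℤ.* (+ N - + m)
    ∎
  where
  open ≡-Reasoning
  shift : ∀ L M → L - M ≡ (L ℤ.+ M) - + 2 ℤ.* M
  shift = ℤ-solve-∀
  factor : ∀ L M → + 2 ℤ.* L - + 2 ℤ.* M ≡ + 2 ℤ.* (L - M)
  factor = ℤ-solve-∀

theorem5p5 : (n : ℕ) (G : FinGroup n) (ℓ : ℕ) (T : PartialTransversal G ℓ) →
    Maximal G T → 5 * ℓ < 3 * n →
    Σ ℕ λ m → (n ≡ 2 * m) × HasSubgroupOfIndex2 G ×
      (∃ λ (k : ℤ) → (+ ℓ) - (+ m) ≡ (+ 2) Data.Integer.* k)
theorem5p5 n G ℓ 𝒯 maximal 5ℓ<3n =
  count H , n≡2∣H∣ , (tabulate H , tabulate-isSubgroup H H-ε H-∙ H-⁻¹ , n≡2∣tabulate-H∣) ,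
  (+ N - + count H , even-sum⇒even-difference {ℓ} {count H} ℓ+∣H∣≡2N)
  where
  open MaximalTransversal 𝒯 maximal
  open Short (5ℓ<3n⇒2ℓ<3k 5ℓ<3n)
  open FiniteGroup G using (tabulate-isSubgroup)
  n≡2∣H∣ : n ≡ 2 * count H
  n≡2∣H∣ = trans (sym index-two) (cong (λ c → count H + c) (sym (+-identityʳ (count H))))
  n≡2∣tabulate-H∣ : n ≡ 2 * ∣ tabulate H ∣
  n≡2∣tabulate-H∣ = trans n≡2∣H∣ (cong (2 *_) (sym (∣tabulate∣ H)))
  N : ℕ
  N = proj₁ ℓ+∣H∣-even
  ℓ+∣H∣≡2N : ℓ + count H ≡ 2 * N
  ℓ+∣H∣≡2N = proj₂ ℓ+∣H∣-even
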